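{- Let $C_8\subset\{0,1\}^8$ be an $(8,16,4)$-code, and let $B\subset\{0,1\}^8$ be an $(8,128,2)$-code containing $00000000$. Then $$D=\{(x+y,\;x+z,\;x+y+z)\mid x\in C_8,\ y,z\in B\}\subset\{0,1\}^{24}$$ is a $(24,2^{18},4)$-code.
   Context: Binary words are vectors of $\mathbb{F}_2^n$ with addition mod 2; $(u,v,w)$ denotes concatenation. An $(n,M,d)$-code is a set of $M$ binary words of length $n$ whose pairwise Hamming distances are at least $d$. -}

module Defs where

open import Data.Bool using (Bool; true; false; _xor_)
open import Data.Nat using (ℕ; zero; suc; _≤_)
open import Data.Vec using (Vec; []; _∷_; zipWith; replicate; _++_)
open import Data.List using (List; length)
open import Data.List.Membership.Propositional using (_∈_)
open import Data.List.Relation.Unary.Unique.Propositional using (Unique)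
open import Data.Product using (_×_; ∃-syntax)
open import Relation.Binary.PropositionalEquality using (_≡_; _≢_)

Word : ℕ → Set
Word n = Vec Bool n

_⊕_ : ∀ {n} → Word n → Word n → Word n
_⊕_ = zipWith _xor_

infixl 6 _⊕_

dist : ∀ {n} → Word n → Word n → ℕ
dist [] [] = 0
dist (a ∷ u) (b ∷ v) with a xor b
... | true  = suc (dist u v)
... | false = dist u v

zeroWord : (n : ℕ) → Word n
zeroWord n = replicate n false

record IsCode (n M d : ℕ) (C : List (Word n)) : Set where
  field
    distinct  : Unique C
    size      : length C ≡ M
    minDist   : ∀ {u v} → u ∈ C → v ∈ C → u ≢ v → d ≤ dist u v

InD : List (Word 8) → List (Word 8) → Word 24 → Set
InD C8 B w = ∃[ x ] ∃[ y ] ∃[ z ]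
  (x ∈ C8 × y ∈ B × z ∈ B × w ≡ (x ⊕ y) ++ ((x ⊕ z) ++ (x ⊕ y ⊕ z)))

module Submission where

open import Defs
open import Data.Nat using (_^_)
open import Data.List using (List)
open import Data.List.Membership.Propositional using (_∈_)
open import Data.Product using (Σ; _×_)
open import Function.Bundles using (_⇔_)

open import Algebra.Bundles using (CommutativeSemigroup)
import Algebra.Properties.CommutativeSemigroup as CommSemigroupProperties
open import Data.Bool using (true; false; _xor_; _≟_)
open import Data.Bool.Properties using (xor-assoc; xor-comm; xor-same; xor-identityˡ)
open import Data.Nat using (ℕ; suc; _+_; _*_; _≤_; s≤s; z≤n)
open import Data.Nat.Properties
  using (≤-refl; ≤-trans; ≤-reflexive; +-mono-≤; +-monoˡ-≤; +-monoʳ-≤; +-assoc; +-comm; +-suc; m≤n⇒m≤1+n; n≤1+n; +-commutativeSemigroup; module ≤-Reasoning)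
open import Data.List using ([]; _∷_; map; length; cartesianProduct)
open import Data.List.Properties using (length-map; length-++)
open import Data.List.Membership.Propositional.Properties
  using (∈-map⁺; ∈-map⁻; ∈-cartesianProduct⁺; ∈-cartesianProduct⁻)
import Data.List as List
import Data.List.Relation.Unary.Unique.Propositional.Properties as Unique
open import Data.Product using (_,_; ∃-syntax)
open import Data.Vec using ([]; _∷_; _++_)
open import Data.Vec.Properties using (zipWith-assoc; zipWith-comm; zipWith-identityˡ; ++-injective; ≡-dec)
open import Function.Bundles using (mk⇔; Equivalence)
open import Level using (0ℓ)
open import Relation.Binary.PropositionalEquality
open import Relation.Binary.PropositionalEquality.Algebra using (isMagma)
open import Relation.Nullary using (yes; no)

-- The map (x, y, z) ↦ (x+y, x+z, x+y+z) is injective because x is the sum of the three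
-- blocks.  If x ≠ x', then x+x' is the sum of the three block differences, so the
-- distance of the images is at least d(x, x') ≥ 4.  If x = x', the block distances
-- are the weights of u = y+y', v = z+z' and u+v; each is at most the sum of the other
-- two, and u or v is a nonzero word of weight ≥ 2, so the total is ≥ 4.

private
  variable
    n : ℕ

⊕-assoc : (u v w : Word n) → (u ⊕ v) ⊕ w ≡ u ⊕ (v ⊕ w)
⊕-assoc = zipWith-assoc xor-assoc

⊕-comm : (u v : Word n) → u ⊕ v ≡ v ⊕ u
⊕-comm = zipWith-comm xor-comm

⊕-identityˡ : (u : Word n) → zeroWord n ⊕ u ≡ u
⊕-identityˡ = zipWith-identityˡ xor-identityˡ

⊕-same : (u : Word n) → u ⊕ u ≡ zeroWord n
⊕-same []      = refl
⊕-same (a ∷ u) = cong₂ _∷_ (xor-same a) (⊕-same u)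

⊕-commutativeSemigroup : ℕ → CommutativeSemigroup 0ℓ 0ℓ
⊕-commutativeSemigroup n = record
  { _∙_                    = _⊕_ {n}
  ; isCommutativeSemigroup = record
    { isSemigroup = record { isMagma = isMagma _⊕_ ; assoc = ⊕-assoc }
    ; comm        = ⊕-comm
    }
  }

⊕-interchange : (u v u' v' : Word n) → (u ⊕ v) ⊕ (u' ⊕ v') ≡ (u ⊕ u') ⊕ (v ⊕ v')
⊕-interchange {n} = CommSemigroupProperties.interchange (⊕-commutativeSemigroup n)

xx⊕uv≡uv : (x u v : Word n) → (x ⊕ x) ⊕ (u ⊕ v) ≡ u ⊕ v
xx⊕uv≡uv x u v = trans (cong (_⊕ (u ⊕ v)) (⊕-same x)) (⊕-identityˡ (u ⊕ v))

x⊕xy≡y : (x y : Word n) → x ⊕ (x ⊕ y) ≡ y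
x⊕xy≡y x y = trans (sym (⊕-assoc x x y)) (trans (cong (_⊕ y) (⊕-same x)) (⊕-identityˡ y))

xy⊕y≡x : (x y : Word n) → (x ⊕ y) ⊕ y ≡ x
xy⊕y≡x x y = trans (⊕-comm (x ⊕ y) y) (trans (cong (y ⊕_) (⊕-comm x y)) (x⊕xy≡y y x))

xy⊕xz⊕xyz≡x : (x y z : Word n) → (x ⊕ y) ⊕ (x ⊕ z) ⊕ (x ⊕ y ⊕ z) ≡ x
xy⊕xz⊕xyz≡x x y z = begin
  (x ⊕ y) ⊕ (x ⊕ z) ⊕ ((x ⊕ y) ⊕ z)  ≡⟨ ⊕-interchange (x ⊕ y) (x ⊕ z) (x ⊕ y) z ⟩
  ((x ⊕ y) ⊕ (x ⊕ y)) ⊕ ((x ⊕ z) ⊕ z) ≡⟨ xx⊕uv≡uv (x ⊕ y) (x ⊕ z) z ⟩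
  (x ⊕ z) ⊕ z                          ≡⟨ xy⊕y≡x x z ⟩
  x                                    ∎
  where open ≡-Reasoning

weight : Word n → ℕ
weight []          = 0
weight (true  ∷ u) = suc (weight u)
weight (false ∷ u) = weight u

weight-⊕-≤ : (u v : Word n) → weight (u ⊕ v) ≤ weight u + weight v
weight-⊕-≤ []          []          = z≤n
weight-⊕-≤ (true  ∷ u) (true  ∷ v) =
  m≤n⇒m≤1+n (≤-trans (weight-⊕-≤ u v) (+-monoʳ-≤ (weight u) (n≤1+n (weight v))))
weight-⊕-≤ (true  ∷ u) (false ∷ v) = s≤s (weight-⊕-≤ u v)
weight-⊕-≤ (false ∷ u) (true  ∷ v) =
  ≤-trans (s≤s (weight-⊕-≤ u v)) (≤-reflexive (sym (+-suc (weight u) (weight v))))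
weight-⊕-≤ (false ∷ u) (false ∷ v) = weight-⊕-≤ u v

dist≡weight-⊕ : (u v : Word n) → dist u v ≡ weight (u ⊕ v)
dist≡weight-⊕ []      []      = refl
dist≡weight-⊕ (a ∷ u) (b ∷ v) with a xor b
... | true  = cong suc (dist≡weight-⊕ u v)
... | false = dist≡weight-⊕ u v

dist-⊕-≤ : (u v u' v' : Word n) → dist (u ⊕ v) (u' ⊕ v') ≤ dist u u' + dist v v'
dist-⊕-≤ u v u' v' = begin
  dist (u ⊕ v) (u' ⊕ v')               ≡⟨ dist≡weight-⊕ (u ⊕ v) (u' ⊕ v') ⟩
  weight ((u ⊕ v) ⊕ (u' ⊕ v'))         ≡⟨ cong weight (⊕-interchange u v u' v') ⟩
  weight ((u ⊕ u') ⊕ (v ⊕ v'))         ≤⟨ weight-⊕-≤ (u ⊕ u') (v ⊕ v') ⟩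
  weight (u ⊕ u') + weight (v ⊕ v')    ≡⟨ sym (cong₂ _+_ (dist≡weight-⊕ u u') (dist≡weight-⊕ v v')) ⟩
  dist u u' + dist v v'                ∎
  where open ≤-Reasoning

dist-⊕ˡ : (x u v : Word n) → dist (x ⊕ u) (x ⊕ v) ≡ dist u v
dist-⊕ˡ x u v = begin
  dist (x ⊕ u) (x ⊕ v)          ≡⟨ dist≡weight-⊕ (x ⊕ u) (x ⊕ v) ⟩
  weight ((x ⊕ u) ⊕ (x ⊕ v))    ≡⟨ cong weight (⊕-interchange x u x v) ⟩
  weight ((x ⊕ x) ⊕ (u ⊕ v))    ≡⟨ cong weight (xx⊕uv≡uv x u v) ⟩
  weight (u ⊕ v)                ≡⟨ sym (dist≡weight-⊕ u v) ⟩
  dist u v                      ∎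
  where open ≡-Reasoning

dist-++ : ∀ {m} (u u' : Word m) (v v' : Word n) → dist (u ++ v) (u' ++ v') ≡ dist u u' + dist v v'
dist-++ []      []        v v' = refl
dist-++ (a ∷ u) (a' ∷ u') v v' with a xor a'
... | true  = cong suc (dist-++ u u' v v')
... | false = dist-++ u u' v v'

encode : Word n × Word n × Word n → Word (n + (n + n))
encode (x , y , z) = (x ⊕ y) ++ ((x ⊕ z) ++ (x ⊕ y ⊕ z))

construction : List (Word n) → List (Word n) → List (Word (n + (n + n)))
construction C B = map encode (cartesianProduct C (cartesianProduct B B))

InConstruction : List (Word n) → List (Word n) → Word (n + (n + n)) → Set
InConstruction C B w = ∃[ x ] ∃[ y ] ∃[ z ] (x ∈ C × y ∈ B × z ∈ B × w ≡ encode (x , y , z))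

encode-injective : {t t' : Word n × Word n × Word n} → encode t ≡ encode t' → t ≡ t'
encode-injective {t = x , y , z} {x' , y' , z'} eq
  with ++-injective (x ⊕ y) (x' ⊕ y') eq
... | xy≡ , rest with ++-injective (x ⊕ z) (x' ⊕ z') rest
... | xz≡ , xyz≡ with x≡x'
  where
  x≡x' : x ≡ x'
  x≡x' = trans (sym (xy⊕xz⊕xyz≡x x y z))
           (trans (cong₂ _⊕_ (cong₂ _⊕_ xy≡ xz≡) xyz≡) (xy⊕xz⊕xyz≡x x' y' z'))
... | refl = cong₂ _,_ refl (cong₂ _,_ (recover y y' xy≡) (recover z z' xz≡))
  where
  recover : (w w' : Word _) → x ⊕ w ≡ x ⊕ w' → w ≡ w'
  recover w w' e = trans (sym (x⊕xy≡y x w)) (trans (cong (x ⊕_) e) (x⊕xy≡y x w'))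

dist-encode : (x y z x' y' z' : Word n) →
  dist (encode (x , y , z)) (encode (x' , y' , z'))
    ≡ dist (x ⊕ y) (x' ⊕ y') + (dist (x ⊕ z) (x' ⊕ z') + dist (x ⊕ y ⊕ z) (x' ⊕ y' ⊕ z'))
dist-encode x y z x' y' z' =
  trans (dist-++ (x ⊕ y) (x' ⊕ y') _ _) (cong (dist (x ⊕ y) (x' ⊕ y') +_) (dist-++ (x ⊕ z) (x' ⊕ z') _ _))

dist-≤-dist-encode : (x y z x' y' z' : Word n) → dist x x' ≤ dist (encode (x , y , z)) (encode (x' , y' , z'))
dist-≤-dist-encode x y z x' y' z' = begin
  dist x x'                                   ≡⟨ sym (cong₂ dist (xy⊕xz⊕xyz≡x x y z) (xy⊕xz⊕xyz≡x x' y' z')) ⟩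
  dist ((x ⊕ y) ⊕ (x ⊕ z) ⊕ (x ⊕ y ⊕ z)) ((x' ⊕ y') ⊕ (x' ⊕ z') ⊕ (x' ⊕ y' ⊕ z'))
                                              ≤⟨ dist-⊕-≤ ((x ⊕ y) ⊕ (x ⊕ z)) (x ⊕ y ⊕ z) ((x' ⊕ y') ⊕ (x' ⊕ z')) (x' ⊕ y' ⊕ z') ⟩
  dist ((x ⊕ y) ⊕ (x ⊕ z)) ((x' ⊕ y') ⊕ (x' ⊕ z')) + c
                                              ≤⟨ +-monoˡ-≤ c (dist-⊕-≤ (x ⊕ y) (x ⊕ z) (x' ⊕ y') (x' ⊕ z')) ⟩
  a + b + c                                   ≡⟨ +-assoc a b c ⟩
  a + (b + c)                                 ≡⟨ sym (dist-encode x y z x' y' z') ⟩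
  dist (encode (x , y , z)) (encode (x' , y' , z')) ∎
  where
  open ≤-Reasoning
  a = dist (x ⊕ y) (x' ⊕ y')
  b = dist (x ⊕ z) (x' ⊕ z')
  c = dist (x ⊕ y ⊕ z) (x' ⊕ y' ⊕ z')

dist-encode-sameFirst : (x y z y' z' : Word n) →
  dist (encode (x , y , z)) (encode (x , y' , z')) ≡ dist y y' + (dist z z' + dist (y ⊕ z) (y' ⊕ z'))
dist-encode-sameFirst x y z y' z' = begin
  dist (encode (x , y , z)) (encode (x , y' , z'))
    ≡⟨ dist-encode x y z x y' z' ⟩
  dist (x ⊕ y) (x ⊕ y') + (dist (x ⊕ z) (x ⊕ z') + dist (x ⊕ y ⊕ z) (x ⊕ y' ⊕ z'))
    ≡⟨ cong₂ (λ p q → dist (x ⊕ y) (x ⊕ y') + (dist (x ⊕ z) (x ⊕ z') + dist p q)) (⊕-assoc x y z) (⊕-assoc x y' z') ⟩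
  dist (x ⊕ y) (x ⊕ y') + (dist (x ⊕ z) (x ⊕ z') + dist (x ⊕ (y ⊕ z)) (x ⊕ (y' ⊕ z')))
    ≡⟨ cong₂ _+_ (dist-⊕ˡ x y y') (cong₂ _+_ (dist-⊕ˡ x z z') (dist-⊕ˡ x (y ⊕ z) (y' ⊕ z'))) ⟩
  dist y y' + (dist z z' + dist (y ⊕ z) (y' ⊕ z'))
    ∎
  where open ≡-Reasoning

dist-≤-dist-⊕ˡ : (u v u' v' : Word n) → dist v v' ≤ dist u u' + dist (u ⊕ v) (u' ⊕ v')
dist-≤-dist-⊕ˡ u v u' v' = begin
  dist v v'                              ≡⟨ sym (cong₂ dist (x⊕xy≡y u v) (x⊕xy≡y u' v')) ⟩
  dist (u ⊕ (u ⊕ v)) (u' ⊕ (u' ⊕ v'))    ≤⟨ dist-⊕-≤ u (u ⊕ v) u' (u' ⊕ v') ⟩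
  dist u u' + dist (u ⊕ v) (u' ⊕ v')     ∎
  where open ≤-Reasoning

dist-≤-dist-⊕ʳ : (u v u' v' : Word n) → dist u u' ≤ dist v v' + dist (u ⊕ v) (u' ⊕ v')
dist-≤-dist-⊕ʳ u v u' v' = begin
  dist u u'                              ≡⟨ sym (cong₂ dist (xy⊕y≡x u v) (xy⊕y≡x u' v')) ⟩
  dist ((u ⊕ v) ⊕ v) ((u' ⊕ v') ⊕ v')    ≤⟨ dist-⊕-≤ (u ⊕ v) v (u' ⊕ v') v' ⟩
  dist (u ⊕ v) (u' ⊕ v') + dist v v'     ≡⟨ +-comm (dist (u ⊕ v) (u' ⊕ v')) (dist v v') ⟩
  dist v v' + dist (u ⊕ v) (u' ⊕ v')     ∎
  where open ≤-Reasoning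

double-minDist-≤ : ∀ {M e B} → IsCode n M e B → ∀ {y z y' z'} → y ∈ B → z ∈ B → y' ∈ B → z' ∈ B →
  (y , z) ≢ (y' , z') → e + e ≤ dist y y' + (dist z z' + dist (y ⊕ z) (y' ⊕ z'))
double-minDist-≤ {e = e} cB {y} {z} {y'} {z'} y∈ z∈ y'∈ z'∈ yz≢y'z' with ≡-dec _≟_ y y'
... | no y≢y' = begin
  e + e                                            ≤⟨ +-mono-≤ e≤a e≤a ⟩
  dist y y' + dist y y'                            ≤⟨ +-monoʳ-≤ (dist y y') (dist-≤-dist-⊕ʳ y z y' z') ⟩
  dist y y' + (dist z z' + dist (y ⊕ z) (y' ⊕ z')) ∎
  where
  open ≤-Reasoning
  e≤a = IsCode.minDist cB y∈ y'∈ y≢y'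
... | yes refl = begin
  e + e                                            ≤⟨ +-mono-≤ e≤b e≤b ⟩
  dist z z' + dist z z'                            ≤⟨ +-monoʳ-≤ (dist z z') (dist-≤-dist-⊕ˡ y z y z') ⟩
  dist z z' + (dist y y + dist (y ⊕ z) (y ⊕ z'))   ≡⟨ x∙yz≈y∙xz (dist z z') (dist y y) _ ⟩
  dist y y + (dist z z' + dist (y ⊕ z) (y ⊕ z'))   ∎
  where
  open ≤-Reasoning
  open CommSemigroupProperties +-commutativeSemigroup using (x∙yz≈y∙xz)
  e≤b = IsCode.minDist cB z∈ z'∈ (λ z≡z' → yz≢y'z' (cong (y ,_) z≡z'))

dist-encode-≥ : ∀ {M M' d e C B} → IsCode n M d C → IsCode n M' e B → d ≤ e + e →
  ∀ {x y z x' y' z'} → x ∈ C → y ∈ B → z ∈ B → x' ∈ C → y' ∈ B → z' ∈ B →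
  (x , y , z) ≢ (x' , y' , z') → d ≤ dist (encode (x , y , z)) (encode (x' , y' , z'))
dist-encode-≥ {d = d} {e} cC cB d≤e+e {x} {y} {z} {x'} {y'} {z'} x∈ y∈ z∈ x'∈ y'∈ z'∈ t≢t' with ≡-dec _≟_ x x'
... | no x≢x'  = ≤-trans (IsCode.minDist cC x∈ x'∈ x≢x') (dist-≤-dist-encode x y z x' y' z')
... | yes refl = begin
  d                                                ≤⟨ d≤e+e ⟩
  e + e                                            ≤⟨ double-minDist-≤ cB y∈ z∈ y'∈ z'∈ (λ yz≡y'z' → t≢t' (cong (x ,_) yz≡y'z')) ⟩
  dist y y' + (dist z z' + dist (y ⊕ z) (y' ⊕ z')) ≡⟨ sym (dist-encode-sameFirst x y z y' z') ⟩
  dist (encode (x , y , z)) (encode (x , y' , z')) ∎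
  where open ≤-Reasoning

length-cartesianProduct : ∀ {a b} {A : Set a} {B : Set b} (xs : List A) (ys : List B) →
  length (cartesianProduct xs ys) ≡ length xs * length ys
length-cartesianProduct []       ys = refl
length-cartesianProduct (x ∷ xs) ys = begin
  length (map (x ,_) ys List.++ cartesianProduct xs ys)      ≡⟨ length-++ (map (x ,_) ys) ⟩
  length (map (x ,_) ys) + length (cartesianProduct xs ys)   ≡⟨ cong₂ _+_ (length-map (x ,_) ys) (length-cartesianProduct xs ys) ⟩
  length ys + length xs * length ys                           ∎
  where open ≡-Reasoning

∈-construction⇔ : {C B : List (Word n)} {w : Word (n + (n + n))} →
  (w ∈ construction C B) ⇔ InConstruction C B w
∈-construction⇔ {C = C} {B} = mk⇔ to from
  where
  to : ∀ {w} → w ∈ construction C B → InConstruction C B w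
  to w∈ with ∈-map⁻ encode w∈
  ... | (x , y , z) , t∈ , w≡ with ∈-cartesianProduct⁻ C (cartesianProduct B B) t∈
  ... | x∈ , yz∈ with ∈-cartesianProduct⁻ B B yz∈
  ... | y∈ , z∈ = x , y , z , x∈ , y∈ , z∈ , w≡
  from : ∀ {w} → InConstruction C B w → w ∈ construction C B
  from (x , y , z , x∈ , y∈ , z∈ , refl) = ∈-map⁺ encode (∈-cartesianProduct⁺ x∈ (∈-cartesianProduct⁺ y∈ z∈))

construction-isCode : ∀ {M M' d e} {C B : List (Word n)} → IsCode n M d C → IsCode n M' e B → d ≤ e + e →
  IsCode (n + (n + n)) (M * (M' * M')) d (construction C B)
construction-isCode {M = M} {M'} {d} {C = C} {B} cC cB d≤e+e = record
  { distinct = Unique.map⁺ encode-injective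
      (Unique.cartesianProduct⁺ (IsCode.distinct cC) (Unique.cartesianProduct⁺ (IsCode.distinct cB) (IsCode.distinct cB)))
  ; size     = begin
      length (construction C B)                                    ≡⟨ length-map encode (cartesianProduct C (cartesianProduct B B)) ⟩
      length (cartesianProduct C (cartesianProduct B B))           ≡⟨ length-cartesianProduct C (cartesianProduct B B) ⟩
      length C * length (cartesianProduct B B)                     ≡⟨ cong (length C *_) (length-cartesianProduct B B) ⟩
      length C * (length B * length B)                             ≡⟨ cong₂ _*_ (IsCode.size cC) (cong₂ _*_ (IsCode.size cB) (IsCode.size cB)) ⟩
      M * (M' * M')                                                ∎
  ; minDist  = minDist
  }
  where
  open ≡-Reasoning
  minDist : ∀ {u v} → u ∈ construction C B → v ∈ construction C B → u ≢ v → d ≤ dist u v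
  minDist u∈ v∈ u≢v with Equivalence.to ∈-construction⇔ u∈ | Equivalence.to ∈-construction⇔ v∈
  ... | x , y , z , x∈ , y∈ , z∈ , refl | x' , y' , z' , x'∈ , y'∈ , z'∈ , refl =
    dist-encode-≥ cC cB d≤e+e x∈ y∈ z∈ x'∈ y'∈ z'∈ (λ t≡t' → u≢v (cong encode t≡t'))

lemma4 : (C8 B : List (Word 8)) → IsCode 8 16 4 C8 → IsCode 8 128 2 B → zeroWord 8 ∈ B →
    Σ (List (Word 24)) λ D → IsCode 24 (2 ^ 18) 4 D × (∀ w → (w ∈ D) ⇔ InD C8 B w)
lemma4 C8 B C8-code B-code _ = construction C8 B , construction-isCode C8-code B-code ≤-refl , λ _ → ∈-construction⇔
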